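{- Let $n=\sum_{i=1}^{\omega(n)}2^{\rho_i}$ with $\rho_{\omega(n)}>\dots>\rho_2>\rho_1\ge 0$ be the binary decomposition of $n\ge 1$. Let $T$ be any MinD tree on $n$ leaves and $c_T(n)$ its Colless index. Then $c_{desc}(n)\le c_T(n)\le c_{asc}(n)$.
   Context: A full binary tree is a rooted tree in which every node has $0$ or $2$ children. An internal node is a $D$-node if its two children have different numbers of descendant leaves (otherwise an $S$-node). A MinD tree on $n$ leaves is a full binary tree with $n$ leaves having the minimum number of $D$-nodes among all such trees; these are exactly the trees obtained from a full binary tree $B$ with $\omega(n)$ leaves (the base tree) by replacing its leaves bijectively with the perfect binary trees with $2^{\rho_1},\dots,2^{\rho_{\omega(n)}}$ leaves. The Colless index of a full binary tree is $\sum |\ell_L(v)-\ell_R(v)|$ over all internal nodes $v$, where $\ell_L(v),\ell_R(v)$ are the numbers of leaves in the left and right subtrees of $v$. A ladder tree is a full binary tree in which every internal node has at least one leaf child. $c_{desc}(n)$ is the Colless index of the MinD tree whose base tree is a ladder tree and whose perfect subtrees are arranged in descending order: the perfect tree with $2^{\rho_{\omega(n)}}$ leaves is a child of the root, the next rung down has the perfect tree with $2^{\rho_{\omega(n)-1}}$ leaves, and so on, with the perfect trees with $2^{\rho_2}$ and $2^{\rho_1}$ leaves as the two children of the lowest $D$-node. $c_{asc}(n)$ is the Colless index of the MinD tree whose base tree is a ladder tree with the perfect subtrees in ascending order: the perfect tree with $2^{\rho_1}$ leaves is a child of the root, then $2^{\rho_2}$ on the next rung, and so on, with the perfect trees with $2^{\rho_{\omega(n)-1}}$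 and $2^{\rho_{\omega(n)}}$ leaves as the two children of the lowest $D$-node. (If $\omega(n)=1$ the tree is perfect and both indices are $0$.) -}

module Defs where

open import Data.Nat using (ℕ; zero; suc; _+_; _≤_; _≡ᵇ_; ∣_-_∣)
open import Data.Bool using (if_then_else_)
open import Data.List using (List; []; _∷_)
open import Data.Product using (_×_)
open import Relation.Binary.PropositionalEquality using (_≡_)

data Tree : Set where
  leaf : Tree
  node : Tree → Tree → Tree

leaves : Tree → ℕ
leaves leaf = 1
leaves (node l r) = leaves l + leaves r

dNodes : Tree → ℕ
dNodes leaf = 0
dNodes (node l r) =
  (if leaves l ≡ᵇ leaves r then 0 else 1) + (dNodes l + dNodes r)

colless : Tree → ℕ
colless leaf = 0
colless (node l r) = ∣ leaves l - leaves r ∣ + (colless l + colless r)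

IsMinD : ℕ → Tree → Set
IsMinD n T = (leaves T ≡ n) × (∀ T' → leaves T' ≡ n → dNodes T ≤ dNodes T')

perfect : ℕ → Tree
perfect zero = leaf
perfect (suc k) = node (perfect k) (perfect k)

-- ladder base tree with perfect subtrees in the given order:
-- ladder (x₁ ∷ x₂ ∷ … ∷ xₘ) has perfect x₁ as child of the root, perfect x₂
-- on the next rung, …, and perfect xₘ₋₁, perfect xₘ as the two children of
-- the lowest node. (The [] case is never used.)
ladder : List ℕ → Tree
ladder [] = leaf
ladder (x ∷ []) = perfect x
ladder (x ∷ y ∷ xs) = node (perfect x) (ladder (y ∷ xs))

{-# OPTIONS --safe #-}
-- A binary expansion of n is a strictly increasing list of exponents ρ with n = Σ 2^ρᵢ.  At an S-node the
-- expansion is that of either half shifted up by one, and at a D-node it arises by adding the expansions of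
-- the two halves, which can only lose one-bits (through carries).  So a tree with n leaves has at least
-- ω(n) − 1 D-nodes, the ladder attains this, and in a MinD tree no D-node produces a carry: its expansion is
-- an interleaving of those of its children.  By induction, colless T then lies between the Colless indices
-- of the descending and ascending ladders, because the ascending ladder of an interleaving arises from the
-- join of the two ascending ladders by repeatedly lifting the smallest perfect tree to the top, and each such
-- rotation can only increase the index (dually, for descending ladders it can only decrease it).
module Submission where

open import Defs
open import Data.Nat using (ℕ; _≤_; _<_; _^_)
open import Data.List using (List; map; reverse)
open import Data.Nat.ListAction using (sum)
open import Data.List.Relation.Unary.Linked using (Linked)
open import Data.Product using (_×_)
open import Relation.Binary.PropositionalEquality using (_≡_)

open import Data.Nat using (zero; suc; _+_; _*_; _∸_; _>_; _≡ᵇ_; ∣_-_∣; s≤s; z≤n; s<s⁻¹)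
open import Data.Nat.Properties
open import Data.Nat.ListAction.Properties using (sum-↭; sum-++)
open import Data.Nat.Induction using (<-wellFounded)
open import Induction.WellFounded using (Acc; acc)
open import Data.List using ([]; _∷_; length; _++_; reverseAcc)
open import Data.List.Properties using (map-++; length-map; reverse-map; length-reverse)
open import Data.List.Relation.Unary.Linked as Linked using ([]; [-]; _∷_)
open import Data.List.Relation.Unary.Linked.Properties using (Linked⇒All)
open import Data.List.Relation.Unary.All using (All; _∷_)
open import Data.List.Relation.Unary.All.Properties using (++⁻)
import Data.List.Relation.Unary.Linked.Properties as Linked
open import Data.List.Relation.Ternary.Interleaving.Propositional
  using (Interleaving; []; consˡ; consʳ; toPermutation; swap)
  renaming (map to Interleaving-map)
open import Data.List.Relation.Ternary.Interleaving.Properties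
  using (interleave-length; reverse⁺) renaming (map⁺ to Interleaving-map⁺)
open import Data.List.Relation.Binary.Permutation.Propositional.Properties
  using (↭-reverse; All-resp-↭) renaming (map⁺ to ↭-map⁺)
open import Data.Product using (∃-syntax; _,_; proj₁; proj₂)
open import Relation.Nullary using (contradiction; yes; no)
open import Data.Bool using (true; false)
open import Data.Unit using (tt)
open import Data.Sum using (_⊎_; inj₁; inj₂)
open import Function using (flip; _∘_)
open import Relation.Binary.PropositionalEquality using (_≢_; refl; sym; trans; cong; cong₂; subst; subst₂; module ≡-Reasoning)
open import Data.Nat.Solver using (module +-*-Solver)
open +-*-Solver using (solve; _:+_; _:*_; _:=_; con)

Interleaving-[]ˡ : ∀ {τ υ : List ℕ} → Interleaving [] τ υ → υ ≡ τ
Interleaving-[]ˡ [] = refl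
Interleaving-[]ˡ (consʳ sp) = cong (_ ∷_) (Interleaving-[]ˡ sp)

Interleaving-[]ʳ : ∀ {σ υ : List ℕ} → Interleaving σ [] υ → υ ≡ σ
Interleaving-[]ʳ sp = Interleaving-[]ˡ (swap sp)

All-interleaving : ∀ {P : ℕ → Set} {σ τ υ} → Interleaving σ τ υ → All P υ → All P σ × All P τ
All-interleaving {σ = σ} sp = ++⁻ σ ∘ All-resp-↭ (toPermutation sp)

Linked-reverse : ∀ {R : ℕ → ℕ → Set} {σ} → Linked R σ → Linked (flip R) (reverse σ)
Linked-reverse {σ = []} _ = []
Linked-reverse {R} {x ∷ σ} l = go σ [-] l
  where
  go : ∀ {x acc} σ → Linked (flip R) (x ∷ acc) → Linked R (x ∷ σ) → Linked (flip R) (reverseAcc (x ∷ acc) σ)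
  go [] la _ = la
  go (y ∷ σ) la (p ∷ l) = go σ (p ∷ la) l

Linked-map-suc : ∀ {σ} → Linked _<_ σ → Linked _<_ (map suc σ)
Linked-map-suc l = Linked.map⁺ (Linked.map s≤s l)

Linked-0∷map-suc : ∀ {σ} → Linked _<_ σ → Linked _<_ (0 ∷ map suc σ)
Linked-0∷map-suc [] = [-]
Linked-0∷map-suc l@[-] = s≤s z≤n ∷ Linked-map-suc l
Linked-0∷map-suc l@(_ ∷ _) = s≤s z≤n ∷ Linked-map-suc l

-- Binary expansions
value : List ℕ → ℕ
value σ = sum (map (2 ^_) σ)

value-map-suc : ∀ σ → value (map suc σ) ≡ 2 * value σ
value-map-suc [] = refl
value-map-suc (x ∷ σ) =
  trans (cong (2 * 2 ^ x +_) (value-map-suc σ)) (sym (*-distribˡ-+ 2 (2 ^ x) (value σ)))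

value-interleaving : ∀ {σ τ υ} → Interleaving σ τ υ → value υ ≡ value σ + value τ
value-interleaving {σ} {τ} {υ} sp = begin
  value υ                             ≡⟨ sum-↭ (↭-map⁺ (2 ^_) (toPermutation sp)) ⟩
  sum (map (2 ^_) (σ ++ τ))           ≡⟨ cong sum (map-++ (2 ^_) σ τ) ⟩
  sum (map (2 ^_) σ ++ map (2 ^_) τ)  ≡⟨ sum-++ (map (2 ^_) σ) (map (2 ^_) τ) ⟩
  value σ + value τ                   ∎
  where open ≡-Reasoning

value-reverse : ∀ σ → value (reverse σ) ≡ value σ
value-reverse σ = trans (cong sum (reverse-map (2 ^_) σ)) (sum-↭ (↭-reverse (map (2 ^_) σ)))

0<value : ∀ x σ → 0 < value (x ∷ σ)
0<value x σ = <-≤-trans (m^n>0 2 x) (m≤m+n (2 ^ x) (value σ))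

value≡0⇒[] : ∀ {σ} → value σ ≡ 0 → σ ≡ []
value≡0⇒[] {[]} _ = refl
value≡0⇒[] {x ∷ σ} e = contradiction e (>⇒≢ (0<value x σ))

value<2^head : ∀ {x σ} → Linked _>_ (x ∷ σ) → value σ < 2 ^ x
value<2^head {x} {[]} _ = m^n>0 2 x
value<2^head {x} {y ∷ σ} (y<x ∷ l) = begin-strict
  2 ^ y + value σ  <⟨ +-monoʳ-< (2 ^ y) (value<2^head l) ⟩
  2 ^ y + 2 ^ y    ≡⟨ cong (2 ^ y +_) (+-identityʳ (2 ^ y)) ⟨
  2 ^ suc y        ≤⟨ ^-monoʳ-≤ 2 y<x ⟩
  2 ^ x            ∎
  where open ≤-Reasoning

value<value-map-suc : ∀ σ → 0 < value σ → value σ < value (map suc σ)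
value<value-map-suc σ p = subst (value σ <_) (sym (value-map-suc σ)) (m<m+n (value σ) (≤-trans p (m≤m+n _ 0)))

value≤value-map-suc : ∀ σ → value σ ≤ value (map suc σ)
value≤value-map-suc σ = subst (value σ ≤_) (sym (value-map-suc σ)) (m≤m+n (value σ) _)

data Parity : List ℕ → Set where
  even : ∀ {σ} → Linked _<_ σ → Parity (map suc σ)
  odd  : ∀ {σ} → Linked _<_ σ → Parity (0 ∷ map suc σ)

parity : ∀ {σ} → Linked _<_ σ → Parity σ
parity {[]} _ = even {[]} []
parity {zero ∷ σ} l with parity (Linked.tail l)
... | even {σ′} _ = odd {σ′} (Linked.map s<s⁻¹ (Linked.map⁻ (Linked.tail l)))
... | odd _ with () ← Linked.head l
parity {suc x ∷ σ} l with parity (Linked.tail l)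
... | even {σ′} _ = even {x ∷ σ′} (Linked.map s<s⁻¹ (Linked.map⁻ l))
... | odd _ with () ← Linked.head l

halve-even : ∀ {υ} k → Linked _<_ υ → value υ ≡ 2 * k →
  ∃[ υ′ ] (υ ≡ map suc υ′ × Linked _<_ υ′ × value υ′ ≡ k)
halve-even k l e with parity l
... | even {υ′} l′ = υ′ , refl , l′ , *-cancelˡ-≡ _ _ 2 (trans (sym (value-map-suc υ′)) e)
... | odd {υ′} _ = contradiction (trans (sym e) (cong suc (value-map-suc υ′))) (even≢odd k (value υ′))

halve-odd : ∀ {υ} k → Linked _<_ υ → value υ ≡ suc (2 * k) →
  ∃[ υ′ ] (υ ≡ 0 ∷ map suc υ′ × Linked _<_ υ′ × value υ′ ≡ k)
halve-odd k l e with parity l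
... | even {υ′} _ = contradiction (trans (sym (value-map-suc υ′)) e) (even≢odd (value υ′) k)
... | odd {υ′} l′ =
  υ′ , refl , l′ , *-cancelˡ-≡ _ _ 2 (suc-injective (trans (cong suc (sym (value-map-suc υ′))) e))

value≡1⇒[0] : ∀ {σ} → Linked _<_ σ → value σ ≡ 1 → σ ≡ 0 ∷ []
value≡1⇒[0] l e with υ , refl , _ , e′ ← halve-odd 0 l e with refl ← value≡0⇒[] {υ} e′ = refl

halves : ∀ n → ∃[ m ] (n ≡ 2 * m ⊎ n ≡ suc (2 * m))
halves zero = 0 , inj₁ refl
halves (suc n) with halves n
... | m , inj₁ refl = m , inj₂ refl
... | m , inj₂ refl = suc m , inj₁ (sym (*-suc 2 m))

binary-expansion : ∀ n → ∃[ σ ] (Linked _<_ σ × value σ ≡ n)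
binary-expansion n = go n (<-wellFounded n)
  where
  go : ∀ n → Acc _<_ n → ∃[ σ ] (Linked _<_ σ × value σ ≡ n)
  go n (acc rec) with halves n
  ... | zero , inj₁ refl = [] , [] , refl
  ... | suc m , inj₁ refl with go (suc m) (rec (m<m+n (suc m) (s≤s z≤n)))
  ...   | σ , l , e = map suc σ , Linked-map-suc l , trans (value-map-suc σ) (cong (2 *_) e)
  go n (acc rec) | m , inj₂ refl with go m (rec (s≤s (m≤m+n m (m + 0))))
  ...   | σ , l , e = 0 ∷ map suc σ , Linked-0∷map-suc l , cong suc (trans (value-map-suc σ) (cong (2 *_) e))

-- Adding binary expansions
-- A carry in some column loses a one-bit; without carries the bits of σ and τ occupy distinct columns.
Carry⊎Interleaving : List ℕ → List ℕ → List ℕ → Set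
Carry⊎Interleaving σ τ υ = length υ < length σ + length τ ⊎ Interleaving σ τ υ

Carry⊎Interleaving⇒length≤ : ∀ {σ τ υ} → Carry⊎Interleaving σ τ υ → length υ ≤ length σ + length τ
Carry⊎Interleaving⇒length≤ (inj₁ lt) = <⇒≤ lt
Carry⊎Interleaving⇒length≤ (inj₂ sp) = ≤-reflexive (interleave-length sp)

Carry⊎Interleaving-map-suc : ∀ {σ τ υ} → Carry⊎Interleaving σ τ υ →
  Carry⊎Interleaving (map suc σ) (map suc τ) (map suc υ)
Carry⊎Interleaving-map-suc {σ} {τ} {υ} (inj₁ lt)
  rewrite length-map suc σ | length-map suc τ | length-map suc υ = inj₁ lt
Carry⊎Interleaving-map-suc (inj₂ sp) =
  inj₂ (Interleaving-map⁺ suc suc suc (Interleaving-map (cong suc) (cong suc) sp))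

Carry⊎Interleaving-∷ˡ : ∀ {x σ τ υ} → Carry⊎Interleaving σ τ υ → Carry⊎Interleaving (x ∷ σ) τ (x ∷ υ)
Carry⊎Interleaving-∷ˡ (inj₁ lt) = inj₁ (s≤s lt)
Carry⊎Interleaving-∷ˡ (inj₂ sp) = inj₂ (consˡ sp)

Carry⊎Interleaving-∷ʳ : ∀ {x σ τ υ} → Carry⊎Interleaving σ τ υ → Carry⊎Interleaving σ (x ∷ τ) (x ∷ υ)
Carry⊎Interleaving-∷ʳ {x} {σ} {τ} {υ} (inj₁ lt) = inj₁ (subst (length (x ∷ υ) <_) (sym (+-suc (length σ) (length τ))) (s≤s lt))
Carry⊎Interleaving-∷ʳ (inj₂ sp) = inj₂ (consʳ sp)

value-even+even : ∀ σ τ → value (map suc σ) + value (map suc τ) ≡ 2 * (value σ + value τ)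
value-even+even σ τ rewrite value-map-suc σ | value-map-suc τ = sym (*-distribˡ-+ 2 (value σ) (value τ))

value-even+odd : ∀ σ τ → value (map suc σ) + value (0 ∷ map suc τ) ≡ suc (2 * (value σ + value τ))
value-even+odd σ τ rewrite value-map-suc σ | value-map-suc τ =
  solve 2 (λ a b → con 2 :* a :+ (con 1 :+ con 2 :* b) := con 1 :+ con 2 :* (a :+ b)) refl (value σ) (value τ)

value-odd+even : ∀ σ τ → value (0 ∷ map suc σ) + value (map suc τ) ≡ suc (2 * (value σ + value τ))
value-odd+even σ τ rewrite value-map-suc σ | value-map-suc τ =
  solve 2 (λ a b → (con 1 :+ con 2 :* a) :+ con 2 :* b := con 1 :+ con 2 :* (a :+ b)) refl (value σ) (value τ)

value-odd+odd : ∀ σ τ → value (0 ∷ map suc σ) + value (0 ∷ map suc τ) ≡ 2 * suc (value σ + value τ)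
value-odd+odd σ τ rewrite value-map-suc σ | value-map-suc τ =
  solve 2 (λ a b → (con 1 :+ con 2 :* a) :+ (con 1 :+ con 2 :* b) := con 2 :* (con 1 :+ (a :+ b))) refl (value σ) (value τ)

binary-addition : ∀ {σ τ υ} → Linked _<_ σ → Linked _<_ τ → Linked _<_ υ →
  value σ + value τ ≡ value υ → Carry⊎Interleaving σ τ υ
binary-addition lσ lτ lυ e = go lσ lτ lυ e (<-wellFounded _)
  where
  go : ∀ {σ τ υ} → Linked _<_ σ → Linked _<_ τ → Linked _<_ υ →
    value σ + value τ ≡ value υ → Acc _<_ (value υ) → Carry⊎Interleaving σ τ υ
  go lσ lτ lυ e (acc rec) with parity lσ | parity lτ
  ... | even {σ} l₁ | even {τ} l₂ with halve-even (value σ + value τ) lυ (trans (sym e) (value-even+even σ τ))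
  ...   | [] , refl , _ , e′
          with refl ← value≡0⇒[] {σ} (m+n≡0⇒m≡0 _ (sym e′)) | refl ← value≡0⇒[] {τ} (m+n≡0⇒n≡0 _ (sym e′))
          = inj₂ []
  ...   | x ∷ xs , refl , l₃ , e′ =
          Carry⊎Interleaving-map-suc (go l₁ l₂ l₃ (sym e′) (rec (value<value-map-suc (x ∷ xs) (0<value x xs))))
  go lσ lτ lυ e (acc rec) | even {σ} l₁ | odd {τ} l₂
    with υ , refl , l₃ , e′ ← halve-odd (value σ + value τ) lυ (trans (sym e) (value-even+odd σ τ)) =
    Carry⊎Interleaving-∷ʳ (Carry⊎Interleaving-map-suc (go l₁ l₂ l₃ (sym e′) (rec (s≤s (value≤value-map-suc υ)))))
  go lσ lτ lυ e (acc rec) | odd {σ} l₁ | even {τ} l₂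
    with υ , refl , l₃ , e′ ← halve-odd (value σ + value τ) lυ (trans (sym e) (value-odd+even σ τ)) =
    Carry⊎Interleaving-∷ˡ (Carry⊎Interleaving-map-suc (go l₁ l₂ l₃ (sym e′) (rec (s≤s (value≤value-map-suc υ)))))
  -- Both lowest bits are set: add the halves to ω first, then the carried bit.
  go lσ lτ lυ e (acc rec) | odd {σ} l₁ | odd {τ} l₂
    with υ , refl , l₃ , e′ ← halve-even (suc (value σ + value τ)) lυ (trans (sym e) (value-odd+odd σ τ))
       | ω , lω , eω ← binary-expansion (value σ + value τ) =
    inj₁ (carry-length (Carry⊎Interleaving⇒length≤ (go l₁ l₂ lω (sym eω) (rec (<-trans ω<υ υ<2υ))))
                       (Carry⊎Interleaving⇒length≤ (go lω ([-] {x = 0}) l₃ ω+1≡υ (rec υ<2υ))))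
    where
    υ<2υ : value υ < value (map suc υ)
    υ<2υ = value<value-map-suc υ (subst (0 <_) (sym e′) (s≤s z≤n))
    ω<υ : value ω < value υ
    ω<υ = ≤-reflexive (trans (cong suc eω) (sym e′))
    ω+1≡υ : value ω + value (0 ∷ []) ≡ value υ
    ω+1≡υ = trans (+-comm (value ω) 1) (trans (cong suc eω) (sym e′))
    carry-length : length ω ≤ length σ + length τ → length υ ≤ length ω + 1 →
      length (map suc υ) < length (0 ∷ map suc σ) + length (0 ∷ map suc τ)
    carry-length h₁ h₂ rewrite length-map suc υ | length-map suc σ | length-map suc τ
      | +-suc (length σ) (length τ) | +-comm (length ω) 1 = s≤s (≤-trans h₂ (s≤s h₁))

-- Colless index and D-nodes
leaves-perfect : ∀ k → leaves (perfect k) ≡ 2 ^ k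
leaves-perfect zero = refl
leaves-perfect (suc k) rewrite leaves-perfect k = cong (2 ^ k +_) (sym (+-identityʳ (2 ^ k)))

colless-perfect : ∀ k → colless (perfect k) ≡ 0
colless-perfect zero = refl
colless-perfect (suc k) rewrite colless-perfect k = trans (+-identityʳ _) (∣n-n∣≡0 (leaves (perfect k)))

0<leaves : ∀ T → 0 < leaves T
0<leaves leaf = s≤s z≤n
0<leaves (node l r) = <-≤-trans (0<leaves l) (m≤m+n (leaves l) (leaves r))

leaves-node-≡ : ∀ L R → leaves L ≡ leaves R → leaves (node L R) ≡ 2 * leaves L
leaves-node-≡ L R eq = cong (leaves L +_) (trans (sym eq) (sym (+-identityʳ (leaves L))))

dNodes-node-≡ : ∀ l r → leaves l ≡ leaves r → dNodes (node l r) ≡ dNodes l + dNodes r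
dNodes-node-≡ l r eq with leaves l ≡ᵇ leaves r | ≡⇒≡ᵇ (leaves l) (leaves r) eq
... | true | _ = refl

1+dNodes-node-≢ : ∀ l r → leaves l ≢ leaves r → suc (dNodes (node l r)) ≡ suc (dNodes l) + suc (dNodes r)
1+dNodes-node-≢ l r neq with leaves l ≡ᵇ leaves r | ≡ᵇ⇒≡ (leaves l) (leaves r)
... | true | eq = contradiction (eq tt) neq
... | false | _ = cong suc (sym (+-suc (dNodes l) (dNodes r)))

dNodes-node-≤ : ∀ l r → dNodes (node l r) ≤ suc (dNodes l + dNodes r)
dNodes-node-≤ l r with leaves l ≡ᵇ leaves r
... | true = n≤1+n _
... | false = ≤-refl

dNodes-perfect : ∀ k → dNodes (perfect k) ≡ 0
dNodes-perfect zero = refl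
dNodes-perfect (suc k) rewrite dNodes-node-≡ (perfect k) (perfect k) refl | dNodes-perfect k = refl

colless-node-comm : ∀ l r → colless (node l r) ≡ colless (node r l)
colless-node-comm l r = cong₂ _+_ (∣-∣-comm (leaves l) (leaves r)) (+-comm (colless l) (colless r))

colless-node-mono : ∀ l r l′ r′ → leaves l ≡ leaves l′ → leaves r ≡ leaves r′ →
  colless l ≤ colless l′ → colless r ≤ colless r′ → colless (node l r) ≤ colless (node l′ r′)
colless-node-mono l r l′ r′ el er cl cr rewrite el | er = +-monoʳ-≤ ∣ leaves l′ - leaves r′ ∣ (+-mono-≤ cl cr)

colless-node-≡ : ∀ l r {a b c d} → leaves l ≡ a → leaves r ≡ b → colless l ≡ c → colless r ≡ d →
  colless (node l r) ≡ ∣ a - b ∣ + (c + d)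
colless-node-≡ l r refl refl refl refl = refl

colless-node-self : ∀ T → colless (node T T) ≡ 2 * colless T
colless-node-self T = trans (cong (_+ (colless T + colless T)) (∣n-n∣≡0 (leaves T))) (cong (colless T +_) (sym (+-identityʳ _)))

∣p+l-r∣+∣p-l∣≤∣p-l+r∣+∣l-r∣ : ∀ p l r → p ≤ l → p ≤ r →
  ∣ p + l - r ∣ + ∣ p - l ∣ ≤ ∣ p - l + r ∣ + ∣ l - r ∣
∣p+l-r∣+∣p-l∣≤∣p-l+r∣+∣l-r∣ p l r p≤l p≤r = begin
  ∣ p + l - r ∣ + ∣ p - l ∣             ≤⟨ +-monoˡ-≤ _ (∣-∣-triangle (p + l) l r) ⟩
  ∣ p + l - l ∣ + ∣ l - r ∣ + ∣ p - l ∣  ≡⟨ cong₂ (λ a b → a + ∣ l - r ∣ + b) (∣m+n-n∣≡m p l) (m≤n⇒∣m-n∣≡n∸m p≤l) ⟩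
  p + ∣ l - r ∣ + (l ∸ p)               ≡⟨ solve 3 (λ p d e → p :+ d :+ e := (p :+ e) :+ d) refl p ∣ l - r ∣ (l ∸ p) ⟩
  p + (l ∸ p) + ∣ l - r ∣               ≡⟨ cong (_+ ∣ l - r ∣) (m+[n∸m]≡n p≤l) ⟩
  l + ∣ l - r ∣                         ≤⟨ +-monoˡ-≤ ∣ l - r ∣ (m≤m+n l (r ∸ p)) ⟩
  l + (r ∸ p) + ∣ l - r ∣               ≡⟨ cong (_+ ∣ l - r ∣) (sym (+-∸-assoc l p≤r)) ⟩
  l + r ∸ p + ∣ l - r ∣                 ≡⟨ cong (_+ ∣ l - r ∣) (sym (m≤n⇒∣m-n∣≡n∸m (≤-trans p≤l (m≤m+n l r)))) ⟩
  ∣ p - l + r ∣ + ∣ l - r ∣             ∎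
  where
  open ≤-Reasoning
  ∣m+n-n∣≡m : ∀ m n → ∣ m + n - n ∣ ≡ m
  ∣m+n-n∣≡m m n = trans (∣-∣-comm (m + n) n) (trans (cong (∣ n -_∣) (+-comm m n)) (∣m-m+n∣≡n n m))

∣p-l+r∣+∣l-r∣≤∣p+l-r∣+∣p-l∣ : ∀ p l r → l + r ≤ p →
  ∣ p - l + r ∣ + ∣ l - r ∣ ≤ ∣ p + l - r ∣ + ∣ p - l ∣
∣p-l+r∣+∣l-r∣≤∣p+l-r∣+∣p-l∣ p l r l+r≤p = begin
  ∣ p - l + r ∣ + ∣ l - r ∣  ≤⟨ +-monoʳ-≤ ∣ p - l + r ∣ (≤-trans (∣m-n∣≤m⊔n l r) (m⊔n≤m+n l r)) ⟩
  ∣ p - l + r ∣ + (l + r)    ≡⟨ cong (_+ (l + r)) (m≤n⇒∣n-m∣≡n∸m l+r≤p) ⟩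
  p ∸ (l + r) + (l + r)      ≡⟨ m∸n+n≡m l+r≤p ⟩
  p                          ≡⟨ m+[n∸m]≡n l≤p ⟨
  l + (p ∸ l)                ≤⟨ +-monoˡ-≤ (p ∸ l) (m≤n+m l (p ∸ r)) ⟩
  p ∸ r + l + (p ∸ l)        ≡⟨ cong₂ _+_ (+-∸-comm l r≤p) (m≤n⇒∣n-m∣≡n∸m l≤p) ⟨
  p + l ∸ r + ∣ p - l ∣      ≡⟨ cong (_+ ∣ p - l ∣) (m≤n⇒∣n-m∣≡n∸m (≤-trans r≤p (m≤m+n p l))) ⟨
  ∣ p + l - r ∣ + ∣ p - l ∣  ∎
  where
  open ≤-Reasoning
  l≤p : l ≤ p
  l≤p = ≤-trans (m≤m+n l r) l+r≤p
  r≤p : r ≤ p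
  r≤p = ≤-trans (m≤n+m r l) l+r≤p

colless-node-nodeˡ : ∀ P L R → colless (node (node P L) R) ≡
  (∣ leaves P + leaves L - leaves R ∣ + ∣ leaves P - leaves L ∣) + (colless P + (colless L + colless R))
colless-node-nodeˡ P L R = solve 5 (λ a b c d e → a :+ ((b :+ (c :+ d)) :+ e) := (a :+ b) :+ (c :+ (d :+ e))) refl
  ∣ leaves P + leaves L - leaves R ∣ ∣ leaves P - leaves L ∣ (colless P) (colless L) (colless R)

colless-node-nodeʳ : ∀ P L R → colless (node P (node L R)) ≡
  (∣ leaves P - leaves L + leaves R ∣ + ∣ leaves L - leaves R ∣) + (colless P + (colless L + colless R))
colless-node-nodeʳ P L R = solve 5 (λ a b c d e → a :+ (c :+ (b :+ (d :+ e))) := (a :+ b) :+ (c :+ (d :+ e))) refl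
  ∣ leaves P - leaves L + leaves R ∣ ∣ leaves L - leaves R ∣ (colless P) (colless L) (colless R)

colless-node-monoʳ : ∀ P {U V} → leaves U ≡ leaves V → colless U ≤ colless V → colless (node P U) ≤ colless (node P V)
colless-node-monoʳ P {U} {V} eq le = colless-node-mono P U P V refl eq ≤-refl le

colless-rotate-≤ : ∀ P L R U → leaves P ≤ leaves L → leaves P ≤ leaves R → leaves U ≡ leaves L + leaves R →
  colless (node L R) ≤ colless U → colless (node (node P L) R) ≤ colless (node P U)
colless-rotate-≤ P L R U p≤l p≤r u≡l+r ih = begin
  colless (node (node P L) R)
    ≡⟨ colless-node-nodeˡ P L R ⟩
  (∣ p + l - r ∣ + ∣ p - l ∣) + (colless P + (colless L + colless R))
    ≤⟨ +-monoˡ-≤ _ (∣p+l-r∣+∣p-l∣≤∣p-l+r∣+∣l-r∣ p l r p≤l p≤r) ⟩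
  (∣ p - l + r ∣ + ∣ l - r ∣) + (colless P + (colless L + colless R))
    ≡⟨ colless-node-nodeʳ P L R ⟨
  colless (node P (node L R))
    ≤⟨ colless-node-monoʳ P {node L R} {U} (sym u≡l+r) ih ⟩
  colless (node P U) ∎
  where
  open ≤-Reasoning
  p = leaves P
  l = leaves L
  r = leaves R

colless-rotate-≥ : ∀ P L R U → leaves L + leaves R ≤ leaves P → leaves U ≡ leaves L + leaves R →
  colless U ≤ colless (node L R) → colless (node P U) ≤ colless (node (node P L) R)
colless-rotate-≥ P L R U l+r≤p u≡l+r ih = begin
  colless (node P U)
    ≤⟨ colless-node-monoʳ P {U} {node L R} u≡l+r ih ⟩
  colless (node P (node L R))
    ≡⟨ colless-node-nodeʳ P L R ⟩
  (∣ p - l + r ∣ + ∣ l - r ∣) + (colless P + (colless L + colless R))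
    ≤⟨ +-monoˡ-≤ _ (∣p-l+r∣+∣l-r∣≤∣p+l-r∣+∣p-l∣ p l r l+r≤p) ⟩
  (∣ p + l - r ∣ + ∣ p - l ∣) + (colless P + (colless L + colless R))
    ≡⟨ colless-node-nodeˡ P L R ⟨
  colless (node (node P L) R) ∎
  where
  open ≤-Reasoning
  p = leaves P
  l = leaves L
  r = leaves R

-- Ladders
leaves-ladder-∷ : ∀ x σ → leaves (ladder (x ∷ σ)) ≡ value (x ∷ σ)
leaves-ladder-∷ x [] = trans (leaves-perfect x) (sym (+-identityʳ _))
leaves-ladder-∷ x (y ∷ σ) = cong₂ _+_ (leaves-perfect x) (leaves-ladder-∷ y σ)

leaves-ladder : ∀ σ T → value σ ≡ leaves T → leaves (ladder σ) ≡ leaves T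
leaves-ladder [] T e = contradiction e (<⇒≢ (0<leaves T))
leaves-ladder (x ∷ σ) T e = trans (leaves-ladder-∷ x σ) e

dNodes-ladder : ∀ x σ → dNodes (ladder (x ∷ σ)) ≤ length σ
dNodes-ladder x [] = ≤-reflexive (dNodes-perfect x)
dNodes-ladder x (y ∷ σ) = ≤-trans (dNodes-node-≤ (perfect x) (ladder (y ∷ σ)))
  (s≤s (≤-trans (≤-reflexive (cong (_+ _) (dNodes-perfect x))) (dNodes-ladder y σ)))

colless-ladder-map-suc : ∀ σ → colless (ladder (map suc σ)) ≡ 2 * colless (ladder σ)
colless-ladder-map-suc [] = refl
colless-ladder-map-suc (x ∷ []) = trans (colless-perfect (suc x)) (cong (2 *_) (sym (colless-perfect x)))
colless-ladder-map-suc (x ∷ y ∷ σ) = begin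
  colless (ladder (map suc (x ∷ y ∷ σ)))
    ≡⟨ colless-node-≡ (perfect (suc x)) (ladder (map suc (y ∷ σ))) (leaves-perfect (suc x)) (trans (leaves-ladder-∷ (suc y) (map suc σ)) (value-map-suc (y ∷ σ)))
                      (colless-perfect (suc x)) (colless-ladder-map-suc (y ∷ σ)) ⟩
  ∣ 2 * 2 ^ x - 2 * value (y ∷ σ) ∣ + 2 * colless (ladder (y ∷ σ))
    ≡⟨ cong (_+ 2 * colless (ladder (y ∷ σ))) (*-distribˡ-∣-∣ 2 (2 ^ x) (value (y ∷ σ))) ⟨
  2 * ∣ 2 ^ x - value (y ∷ σ) ∣ + 2 * colless (ladder (y ∷ σ))
    ≡⟨ *-distribˡ-+ 2 ∣ 2 ^ x - value (y ∷ σ) ∣ (colless (ladder (y ∷ σ))) ⟨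
  2 * (∣ 2 ^ x - value (y ∷ σ) ∣ + colless (ladder (y ∷ σ)))
    ≡⟨ cong (2 *_) (colless-node-≡ (perfect x) (ladder (y ∷ σ)) (leaves-perfect x) (leaves-ladder-∷ y σ) (colless-perfect x) refl) ⟨
  2 * colless (ladder (x ∷ y ∷ σ)) ∎
  where open ≡-Reasoning

leaves-ladder-interleaving : ∀ {x σ y τ w υ} → Interleaving (x ∷ σ) (y ∷ τ) (w ∷ υ) →
  leaves (ladder (w ∷ υ)) ≡ leaves (ladder (x ∷ σ)) + leaves (ladder (y ∷ τ))
leaves-ladder-interleaving {x} {σ} {y} {τ} {w} {υ} sp = begin
  leaves (ladder (w ∷ υ))                           ≡⟨ leaves-ladder-∷ w υ ⟩
  value (w ∷ υ)                                     ≡⟨ value-interleaving sp ⟩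
  value (x ∷ σ) + value (y ∷ τ)                     ≡⟨ cong₂ _+_ (leaves-ladder-∷ x σ) (leaves-ladder-∷ y τ) ⟨
  leaves (ladder (x ∷ σ)) + leaves (ladder (y ∷ τ)) ∎
  where open ≡-Reasoning

perfect≤ladder : ∀ {x y τ} → All (x <_) (y ∷ τ) → leaves (perfect x) ≤ leaves (ladder (y ∷ τ))
perfect≤ladder {x} {y} {τ} (x<y ∷ _) = begin
  leaves (perfect x)       ≡⟨ leaves-perfect x ⟩
  2 ^ x                    ≤⟨ ^-monoʳ-≤ 2 (<⇒≤ x<y) ⟩
  2 ^ y                    ≤⟨ m≤m+n (2 ^ y) (value τ) ⟩
  value (y ∷ τ)            ≡⟨ leaves-ladder-∷ y τ ⟨
  leaves (ladder (y ∷ τ))  ∎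
  where open ≤-Reasoning

ladder-interleaving-≤ : ∀ {x σ y τ υ} → Interleaving (x ∷ σ) (y ∷ τ) υ → Linked _<_ υ →
  colless (node (ladder (x ∷ σ)) (ladder (y ∷ τ))) ≤ colless (ladder υ)
ladder-interleaving-≤ {σ = []} (consˡ sp) _ rewrite Interleaving-[]ˡ sp = ≤-refl
ladder-interleaving-≤ {x} {x′ ∷ σ} {y} {τ} {_ ∷ w ∷ υ} (consˡ sp) (x<w ∷ l)
  with x<σ , x<τ ← All-interleaving sp (Linked⇒All <-trans x<w l) =
  colless-rotate-≤ (perfect x) (ladder (x′ ∷ σ)) (ladder (y ∷ τ)) (ladder (w ∷ υ))
    (perfect≤ladder x<σ) (perfect≤ladder x<τ) (leaves-ladder-interleaving sp) (ladder-interleaving-≤ sp l)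
ladder-interleaving-≤ {x} {σ} {y} {[]} (consʳ sp) _ rewrite Interleaving-[]ʳ sp =
  ≤-reflexive (colless-node-comm (ladder (x ∷ σ)) (perfect y))
ladder-interleaving-≤ {x} {σ} {y} {y′ ∷ τ} {_ ∷ w ∷ υ} (consʳ sp) (y<w ∷ l)
  with y<σ , y<τ ← All-interleaving sp (Linked⇒All <-trans y<w l) = begin
  colless (node (ladder (x ∷ σ)) (ladder (y ∷ y′ ∷ τ)))  ≡⟨ colless-node-comm (ladder (x ∷ σ)) (ladder (y ∷ y′ ∷ τ)) ⟩
  colless (node (ladder (y ∷ y′ ∷ τ)) (ladder (x ∷ σ)))
    ≤⟨ colless-rotate-≤ (perfect y) (ladder (y′ ∷ τ)) (ladder (x ∷ σ)) (ladder (w ∷ υ))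
         (perfect≤ladder y<τ) (perfect≤ladder y<σ) (trans (leaves-ladder-interleaving sp) (+-comm (leaves (ladder (x ∷ σ))) _))
         (≤-trans (≤-reflexive (colless-node-comm (ladder (y′ ∷ τ)) (ladder (x ∷ σ)))) (ladder-interleaving-≤ sp l)) ⟩
  colless (ladder (y ∷ w ∷ υ))                            ∎
  where open ≤-Reasoning

ladder<perfect : ∀ {x w υ} → Linked _>_ (x ∷ w ∷ υ) → leaves (ladder (w ∷ υ)) < leaves (perfect x)
ladder<perfect {x} {w} {υ} l =
  subst₂ _<_ (sym (leaves-ladder-∷ w υ)) (sym (leaves-perfect x)) (value<2^head l)

ladder-interleaving-≥ : ∀ {x σ y τ υ} → Interleaving (x ∷ σ) (y ∷ τ) υ → Linked _>_ υ →
  colless (ladder υ) ≤ colless (node (ladder (x ∷ σ)) (ladder (y ∷ τ)))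
ladder-interleaving-≥ {σ = []} (consˡ sp) _ rewrite Interleaving-[]ˡ sp = ≤-refl
ladder-interleaving-≥ {x} {x′ ∷ σ} {y} {τ} {_ ∷ w ∷ υ} (consˡ sp) l =
  colless-rotate-≥ (perfect x) (ladder (x′ ∷ σ)) (ladder (y ∷ τ)) (ladder (w ∷ υ))
    (<⇒≤ (subst (_< _) (leaves-ladder-interleaving sp) (ladder<perfect l)))
    (leaves-ladder-interleaving sp) (ladder-interleaving-≥ sp (Linked.tail l))
ladder-interleaving-≥ {x} {σ} {y} {[]} (consʳ sp) _ rewrite Interleaving-[]ʳ sp =
  ≤-reflexive (colless-node-comm (perfect y) (ladder (x ∷ σ)))
ladder-interleaving-≥ {x} {σ} {y} {y′ ∷ τ} {_ ∷ w ∷ υ} (consʳ sp) l = begin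
  colless (ladder (y ∷ w ∷ υ))
    ≤⟨ colless-rotate-≥ (perfect y) (ladder (y′ ∷ τ)) (ladder (x ∷ σ)) (ladder (w ∷ υ))
         (<⇒≤ (subst (_< _) w≡τ+σ (ladder<perfect l))) w≡τ+σ
         (≤-trans (ladder-interleaving-≥ sp (Linked.tail l)) (≤-reflexive (colless-node-comm (ladder (x ∷ σ)) (ladder (y′ ∷ τ))))) ⟩
  colless (node (ladder (y ∷ y′ ∷ τ)) (ladder (x ∷ σ)))  ≡⟨ colless-node-comm (ladder (y ∷ y′ ∷ τ)) (ladder (x ∷ σ)) ⟩
  colless (node (ladder (x ∷ σ)) (ladder (y ∷ y′ ∷ τ)))  ∎
  where
  open ≤-Reasoning
  w≡τ+σ : leaves (ladder (w ∷ υ)) ≡ leaves (ladder (y′ ∷ τ)) + leaves (ladder (x ∷ σ))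
  w≡τ+σ = trans (leaves-ladder-interleaving sp) (+-comm (leaves (ladder (x ∷ σ))) _)

ladder-interleaving-reverse-≥ : ∀ {x σ y τ υ} → Interleaving (x ∷ σ) (y ∷ τ) υ → Linked _<_ υ →
  colless (ladder (reverse υ)) ≤ colless (node (ladder (reverse (x ∷ σ))) (ladder (reverse (y ∷ τ))))
ladder-interleaving-reverse-≥ {x} {σ} {y} {τ} sp l
  with reverse (x ∷ σ) | length-reverse (x ∷ σ) | reverse (y ∷ τ) | length-reverse (y ∷ τ) | reverse⁺ sp
... | _ ∷ _ | _ | _ ∷ _ | _ | sp′ = ladder-interleaving-≥ sp′ (Linked-reverse l)

-- Trees with the fewest D-nodes
leaves-expansion : ∀ T → ∃[ x ] ∃[ σ ] (Linked _<_ (x ∷ σ) × value (x ∷ σ) ≡ leaves T)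
leaves-expansion T with binary-expansion (leaves T)
... | [] , _ , e = contradiction e (<⇒≢ (0<leaves T))
... | x ∷ σ , l , e = x , σ , l , e

length≤1+dNodes : ∀ T {σ} → Linked _<_ σ → value σ ≡ leaves T → length σ ≤ suc (dNodes T)
length≤1+dNodes leaf l e rewrite value≡1⇒[0] l e = ≤-refl
length≤1+dNodes (node L R) {σ} l e with leaves L ≟ leaves R
... | yes eq with σ , refl , l′ , e′ ← halve-even (leaves L) l (trans e (leaves-node-≡ L R eq))
  rewrite dNodes-node-≡ L R eq | length-map suc σ =
  ≤-trans (length≤1+dNodes L l′ e′) (s≤s (m≤m+n (dNodes L) (dNodes R)))
... | no neq with x , σL , lL , eL ← leaves-expansion L | y , σR , lR , eR ← leaves-expansion R = begin
  length σ                          ≤⟨ Carry⊎Interleaving⇒length≤ (binary-addition lL lR l (trans (cong₂ _+_ eL eR) (sym e))) ⟩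
  length (x ∷ σL) + length (y ∷ σR) ≤⟨ +-mono-≤ (length≤1+dNodes L lL eL) (length≤1+dNodes R lR eR) ⟩
  suc (dNodes L) + suc (dNodes R)   ≡⟨ 1+dNodes-node-≢ L R neq ⟨
  suc (dNodes (node L R))           ∎
  where open ≤-Reasoning

LadderBounded : Tree → Set
LadderBounded T = ∀ {σ} → Linked _<_ σ → value σ ≡ leaves T → length σ ≡ suc (dNodes T) →
  colless (ladder (reverse σ)) ≤ colless T × colless T ≤ colless (ladder σ)

ladderBounded-S : ∀ L R → leaves L ≡ leaves R → LadderBounded L → LadderBounded R → LadderBounded (node L R)
ladderBounded-S L R eq bL bR l e tight
  with σ , refl , l′ , eL ← halve-even (leaves L) l (trans e (leaves-node-≡ L R eq)) = lower , upper
  where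
  open ≤-Reasoning
  eR : value σ ≡ leaves R
  eR = trans eL eq
  tight′ : length σ ≡ suc (dNodes L + dNodes R)
  tight′ = trans (sym (length-map suc σ)) (trans tight (cong suc (dNodes-node-≡ L R eq)))
  tL : length σ ≡ suc (dNodes L)
  tL = ≤-antisym (length≤1+dNodes L l′ eL) (subst (suc (dNodes L) ≤_) (sym tight′) (s≤s (m≤m+n _ _)))
  tR : length σ ≡ suc (dNodes R)
  tR = ≤-antisym (length≤1+dNodes R l′ eR) (subst (suc (dNodes R) ≤_) (sym tight′) (s≤s (m≤n+m _ _)))
  upper : colless (node L R) ≤ colless (ladder (map suc σ))
  upper = begin
    colless (node L R)
      ≤⟨ colless-node-mono L R (ladder σ) (ladder σ) (sym (leaves-ladder σ L eL)) (sym (leaves-ladder σ R eR)) (proj₂ (bL l′ eL tL)) (proj₂ (bR l′ eR tR)) ⟩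
    colless (node (ladder σ) (ladder σ))  ≡⟨ colless-node-self (ladder σ) ⟩
    2 * colless (ladder σ)                ≡⟨ colless-ladder-map-suc σ ⟨
    colless (ladder (map suc σ))          ∎
  lower : colless (ladder (reverse (map suc σ))) ≤ colless (node L R)
  lower = begin
    colless (ladder (reverse (map suc σ)))                    ≡⟨ cong (colless ∘ ladder) (reverse-map suc σ) ⟨
    colless (ladder (map suc (reverse σ)))                    ≡⟨ colless-ladder-map-suc (reverse σ) ⟩
    2 * colless (ladder (reverse σ))                          ≡⟨ colless-node-self (ladder (reverse σ)) ⟨
    colless (node (ladder (reverse σ)) (ladder (reverse σ)))
      ≤⟨ colless-node-mono (ladder (reverse σ)) (ladder (reverse σ)) L R (leaves-ladder (reverse σ) L (trans (value-reverse σ) eL))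
           (leaves-ladder (reverse σ) R (trans (value-reverse σ) eR))
           (proj₁ (bL l′ eL tL)) (proj₁ (bR l′ eR tR)) ⟩
    colless (node L R)                                        ∎

+-≤-tight : ∀ {a b c d} → a ≤ c → b ≤ d → a + b ≡ c + d → a ≡ c × b ≡ d
+-≤-tight {a} {b} {c} {d} a≤c b≤d e =
  ≤-antisym a≤c (+-cancelʳ-≤ d c a (subst (_≤ a + d) e (+-monoʳ-≤ a b≤d))) ,
  ≤-antisym b≤d (+-cancelˡ-≤ c d b (subst (_≤ c + b) e (+-monoˡ-≤ b a≤c)))

ladderBounded-D : ∀ L R → leaves L ≢ leaves R → LadderBounded L → LadderBounded R → LadderBounded (node L R)
ladderBounded-D L R neq bL bR {σ} l e tight
  with x , σL , lL , eL ← leaves-expansion L | y , σR , lR , eR ← leaves-expansion R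
  with binary-addition lL lR l (trans (cong₂ _+_ eL eR) (sym e))
... | inj₁ carry = contradiction (trans tight (1+dNodes-node-≢ L R neq)) (<⇒≢ (<-≤-trans carry lengths≤))
  where
  lengths≤ : length (x ∷ σL) + length (y ∷ σR) ≤ suc (dNodes L) + suc (dNodes R)
  lengths≤ = +-mono-≤ (length≤1+dNodes L lL eL) (length≤1+dNodes R lR eR)
... | inj₂ sp
  with tL , tR ← +-≤-tight (length≤1+dNodes L lL eL) (length≤1+dNodes R lR eR)
                   (trans (sym (interleave-length sp)) (trans tight (1+dNodes-node-≢ L R neq))) = lower , upper
  where
  open ≤-Reasoning
  upper : colless (node L R) ≤ colless (ladder σ)
  upper = begin
    colless (node L R)
      ≤⟨ colless-node-mono L R (ladder (x ∷ σL)) (ladder (y ∷ σR))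
           (sym (leaves-ladder (x ∷ σL) L eL)) (sym (leaves-ladder (y ∷ σR) R eR))
           (proj₂ (bL lL eL tL)) (proj₂ (bR lR eR tR)) ⟩
    colless (node (ladder (x ∷ σL)) (ladder (y ∷ σR)))  ≤⟨ ladder-interleaving-≤ sp l ⟩
    colless (ladder σ)                                  ∎
  lower : colless (ladder (reverse σ)) ≤ colless (node L R)
  lower = begin
    colless (ladder (reverse σ))
      ≤⟨ ladder-interleaving-reverse-≥ sp l ⟩
    colless (node (ladder (reverse (x ∷ σL))) (ladder (reverse (y ∷ σR))))
      ≤⟨ colless-node-mono (ladder (reverse (x ∷ σL))) (ladder (reverse (y ∷ σR))) L R
           (leaves-ladder (reverse (x ∷ σL)) L (trans (value-reverse (x ∷ σL)) eL))
           (leaves-ladder (reverse (y ∷ σR)) R (trans (value-reverse (y ∷ σR)) eR))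
           (proj₁ (bL lL eL tL)) (proj₁ (bR lR eR tR)) ⟩
    colless (node L R) ∎

ladderBounded : ∀ T → LadderBounded T
ladderBounded leaf l e _ rewrite value≡1⇒[0] l e = ≤-refl , ≤-refl
ladderBounded (node L R) with leaves L ≟ leaves R
... | yes eq = ladderBounded-S L R eq (ladderBounded L) (ladderBounded R)
... | no neq = ladderBounded-D L R neq (ladderBounded L) (ladderBounded R)

theorem112 : (n : ℕ) → 1 ≤ n → (ρ : List ℕ) → Linked _<_ ρ →
    sum (map (2 ^_) ρ) ≡ n → (T : Tree) → IsMinD n T →
    (colless (ladder (reverse ρ)) ≤ colless T) × (colless T ≤ colless (ladder ρ))
theorem112 n 1≤n [] _ ρ≡n _ _ = contradiction ρ≡n (<⇒≢ 1≤n)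
theorem112 n _ (x ∷ ρ) l ρ≡n T (T≡n , minimal) = ladderBounded T l ρ≡T (≤-antisym (length≤1+dNodes T l ρ≡T) 1+dT≤ω)
  where
  ρ≡T : value (x ∷ ρ) ≡ leaves T
  ρ≡T = trans ρ≡n (sym T≡n)
  1+dT≤ω : suc (dNodes T) ≤ length (x ∷ ρ)
  1+dT≤ω = s≤s (≤-trans (minimal (ladder (x ∷ ρ)) (trans (leaves-ladder-∷ x ρ) ρ≡n)) (dNodes-ladder x ρ))
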